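{- Let $A$ be a pseudo-BCI algebra and define $d_{\varphi}:A\to A$ by $d_{\varphi}(x)=\varphi_x=(x\to 1)\rightsquigarrow 1$ for all $x\in A$. Then $d_{\varphi}$ is a type I implicative derivation on $A$.
   Context: A pseudo-BCI algebra is a structure $(A,\to,\rightsquigarrow,1)$ of type $(2,2,0)$ such that for all $x,y,z\in A$: $(x\to y)\rightsquigarrow[(y\to z)\rightsquigarrow(x\to z)]=1$; $(x\rightsquigarrow y)\to[(y\rightsquigarrow z)\to(x\rightsquigarrow z)]=1$; $1\to x=x$; $1\rightsquigarrow x=x$; and $x\to y=1$, $y\to x=1$ imply $x=y$. Put $x\Cup_1 y=(x\to y)\rightsquigarrow y$ and $x\Cup_2 y=(x\rightsquigarrow y)\to y$. A map $d:A\to A$ is a type I implicative derivation if $d(x\to y)=(x\to d(y))\Cup_2(d(x)\to y)$ and $d(x\rightsquigarrow y)=(x\rightsquigarrow d(y))\Cup_1(d(x)\rightsquigarrow y)$ for all $x,y\in A$. -}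

module Defs where

open import Level using (Level; suc)
open import Relation.Binary.PropositionalEquality using (_≡_)
open import Data.Product using (_×_)

record PseudoBCI (a : Level) : Set (suc a) where
  infixr 5 _⇒_ _⇝_
  field
    Carrier : Set a
    _⇒_     : Carrier → Carrier → Carrier   -- the paper's →
    _⇝_     : Carrier → Carrier → Carrier
    𝟙       : Carrier
    ax₁ : ∀ x y z → (x ⇒ y) ⇝ ((y ⇒ z) ⇝ (x ⇒ z)) ≡ 𝟙
    ax₂ : ∀ x y z → (x ⇝ y) ⇒ ((y ⇝ z) ⇒ (x ⇝ z)) ≡ 𝟙
    ax₃ : ∀ x → 𝟙 ⇒ x ≡ x
    ax₄ : ∀ x → 𝟙 ⇝ x ≡ x
    ax₅ : ∀ x y → x ⇒ y ≡ 𝟙 → y ⇒ x ≡ 𝟙 → x ≡ y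

  _⋓₁_ : Carrier → Carrier → Carrier
  x ⋓₁ y = (x ⇒ y) ⇝ y

  _⋓₂_ : Carrier → Carrier → Carrier
  x ⋓₂ y = (x ⇝ y) ⇒ y

  dφ : Carrier → Carrier
  dφ x = (x ⇒ 𝟙) ⇝ 𝟙

IsTypeIImplicativeDerivation : ∀ {a} (A : PseudoBCI a) → (PseudoBCI.Carrier A → PseudoBCI.Carrier A) → Set a
IsTypeIImplicativeDerivation A d =
  (∀ x y → d (x ⇒ y) ≡ (x ⇒ d y) ⋓₂ (d x ⇒ y)) ×
  (∀ x y → d (x ⇝ y) ≡ (x ⇝ d y) ⋓₁ (d x ⇝ y))
  where
  open PseudoBCI A

-- Order A by x ≤ y iff x → y = 1 and put x⁻ = x → 1, which by exchange equals x ⇝ 1.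
-- If y ≤ x then x⁻ = x → (y ⇝ x) = y ⇝ (x → x) = y⁻; hence every x⁻ is maximal, and
-- φ_a = a⁻⁻ is the unique maximal element above a. Now x → y ≤ x → φ_y = y⁻ ⇝ x⁻,
-- and y⁻ ⇝ x⁻ lies above the maximal element (y → x)⁻, so x → φ_y is maximal above x → y,
-- i.e. it is φ_{x→y}; being maximal it also equals (x → φ_y) ⋓₂ b ≥ x → φ_y.
-- The case of ⇝ is dual.
module Submission where

open import Defs
open import Data.Product using (_,_)
open import Relation.Binary.PropositionalEquality
open ≡-Reasoning

module Properties {a} (A : PseudoBCI a) where
  open PseudoBCI A

  infix 4 _≤_

  _≤_ : Carrier → Carrier → Set a
  x ≤ y = x ⇒ y ≡ 𝟙

  ≤-antisym : ∀ {x y} → x ≤ y → y ≤ x → x ≡ y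
  ≤-antisym = ax₅ _ _

  x⇒x≡𝟙 : ∀ x → x ⇒ x ≡ 𝟙
  x⇒x≡𝟙 x = begin
    x ⇒ x                         ≡⟨ ax₃ _ ⟨
    𝟙 ⇒ (x ⇒ x)                   ≡⟨ cong₂ (λ u v → u ⇒ (v ⇒ v)) (ax₄ 𝟙) (ax₄ x) ⟨
    (𝟙 ⇝ 𝟙) ⇒ ((𝟙 ⇝ x) ⇒ (𝟙 ⇝ x)) ≡⟨ ax₂ 𝟙 𝟙 x ⟩
    𝟙                             ∎

  x⇝x≡𝟙 : ∀ x → x ⇝ x ≡ 𝟙
  x⇝x≡𝟙 x = begin
    x ⇝ x                         ≡⟨ ax₄ _ ⟨
    𝟙 ⇝ (x ⇝ x)                   ≡⟨ cong₂ (λ u v → u ⇝ (v ⇝ v)) (ax₃ 𝟙) (ax₃ x) ⟨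
    (𝟙 ⇒ 𝟙) ⇝ ((𝟙 ⇒ x) ⇝ (𝟙 ⇒ x)) ≡⟨ ax₁ 𝟙 𝟙 x ⟩
    𝟙                             ∎

  x≤x⋓₂y : ∀ x y → x ≤ x ⋓₂ y
  x≤x⋓₂y x y = begin
    x ⇒ ((x ⇝ y) ⇒ y)                 ≡⟨ cong₂ (λ u v → u ⇒ ((x ⇝ y) ⇒ v)) (ax₄ x) (ax₄ y) ⟨
    (𝟙 ⇝ x) ⇒ ((x ⇝ y) ⇒ (𝟙 ⇝ y)) ≡⟨ ax₂ 𝟙 x y ⟩
    𝟙                                 ∎

  x⇝x⋓₁y≡𝟙 : ∀ x y → x ⇝ x ⋓₁ y ≡ 𝟙
  x⇝x⋓₁y≡𝟙 x y = begin
    x ⇝ ((x ⇒ y) ⇝ y)                 ≡⟨ cong₂ (λ u v → u ⇝ ((x ⇒ y) ⇝ v)) (ax₃ x) (ax₃ y) ⟨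
    (𝟙 ⇒ x) ⇝ ((x ⇒ y) ⇝ (𝟙 ⇒ y)) ≡⟨ ax₁ 𝟙 x y ⟩
    𝟙                                 ∎

  ⇝≡𝟙→≤ : ∀ {x y} → x ⇝ y ≡ 𝟙 → x ≤ y
  ⇝≡𝟙→≤ {x} {y} x⇝y≡𝟙 = begin
    x ⇒ y               ≡⟨ cong (x ⇒_) (ax₃ y) ⟨
    x ⇒ (𝟙 ⇒ y)         ≡⟨ cong (λ u → x ⇒ (u ⇒ y)) x⇝y≡𝟙 ⟨
    x ⇒ ((x ⇝ y) ⇒ y)   ≡⟨ x≤x⋓₂y x y ⟩
    𝟙                   ∎

  ≤→⇝≡𝟙 : ∀ {x y} → x ≤ y → x ⇝ y ≡ 𝟙
  ≤→⇝≡𝟙 {x} {y} x≤y = begin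
    x ⇝ y               ≡⟨ cong (x ⇝_) (ax₄ y) ⟨
    x ⇝ (𝟙 ⇝ y)         ≡⟨ cong (λ u → x ⇝ (u ⇝ y)) x≤y ⟨
    x ⇝ ((x ⇒ y) ⇝ y)   ≡⟨ x⇝x⋓₁y≡𝟙 x y ⟩
    𝟙                   ∎

  x≤x⋓₁y : ∀ x y → x ≤ x ⋓₁ y
  x≤x⋓₁y x y = ⇝≡𝟙→≤ (x⇝x⋓₁y≡𝟙 x y)

  ≤-trans : ∀ {x y z} → x ≤ y → y ≤ z → x ≤ z
  ≤-trans {x} {y} {z} x≤y y≤z = begin
    x ⇒ z                         ≡⟨ ax₄ _ ⟨
    𝟙 ⇝ (x ⇒ z)                   ≡⟨ ax₄ _ ⟨
    𝟙 ⇝ (𝟙 ⇝ (x ⇒ z))             ≡⟨ cong₂ (λ u v → u ⇝ (v ⇝ (x ⇒ z))) x≤y y≤z ⟨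
    (x ⇒ y) ⇝ ((y ⇒ z) ⇝ (x ⇒ z)) ≡⟨ ax₁ x y z ⟩
    𝟙                             ∎

  ⇒-antimonoˡ-≤ : ∀ {x y} z → x ≤ y → y ⇒ z ≤ x ⇒ z
  ⇒-antimonoˡ-≤ {x} {y} z x≤y = ⇝≡𝟙→≤ (begin
    (y ⇒ z) ⇝ (x ⇒ z)             ≡⟨ ax₄ _ ⟨
    𝟙 ⇝ ((y ⇒ z) ⇝ (x ⇒ z))       ≡⟨ cong (λ u → u ⇝ ((y ⇒ z) ⇝ (x ⇒ z))) x≤y ⟨
    (x ⇒ y) ⇝ ((y ⇒ z) ⇝ (x ⇒ z)) ≡⟨ ax₁ x y z ⟩
    𝟙                             ∎)

  ⇝-antimonoˡ-≤ : ∀ {x y} z → x ≤ y → y ⇝ z ≤ x ⇝ z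
  ⇝-antimonoˡ-≤ {x} {y} z x≤y = begin
    (y ⇝ z) ⇒ (x ⇝ z)             ≡⟨ ax₃ _ ⟨
    𝟙 ⇒ ((y ⇝ z) ⇒ (x ⇝ z))       ≡⟨ cong (λ u → u ⇒ ((y ⇝ z) ⇒ (x ⇝ z))) (≤→⇝≡𝟙 x≤y) ⟨
    (x ⇝ y) ⇒ ((y ⇝ z) ⇒ (x ⇝ z)) ≡⟨ ax₂ x y z ⟩
    𝟙                             ∎

  exchange : ∀ x y z → x ⇒ (y ⇝ z) ≡ y ⇝ (x ⇒ z)
  exchange x y z = ≤-antisym
    (≤-trans (⇝≡𝟙→≤ (ax₁ x (y ⇝ z) z)) (⇝-antimonoˡ-≤ (x ⇒ z) (x≤x⋓₂y y z)))
    (≤-trans (ax₂ y (x ⇒ z) z) (⇒-antimonoˡ-≤ (y ⇝ z) (x≤x⋓₁y x z)))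

  infix 8 _⁻
  _⁻ : Carrier → Carrier
  x ⁻ = x ⇒ 𝟙

  x⇝𝟙≡x⁻ : ∀ x → x ⇝ 𝟙 ≡ x ⁻
  x⇝𝟙≡x⁻ x = begin
    x ⇝ 𝟙        ≡⟨ cong (x ⇝_) (x⇒x≡𝟙 x) ⟨
    x ⇝ (x ⇒ x)  ≡⟨ exchange x x x ⟨
    x ⇒ (x ⇝ x)  ≡⟨ cong (x ⇒_) (x⇝x≡𝟙 x) ⟩
    x ⇒ 𝟙        ∎

  x⇒[y⇝x]≡y⁻ : ∀ x y → x ⇒ (y ⇝ x) ≡ y ⁻
  x⇒[y⇝x]≡y⁻ x y = begin
    x ⇒ (y ⇝ x)  ≡⟨ exchange x y x ⟩
    y ⇝ (x ⇒ x)  ≡⟨ cong (y ⇝_) (x⇒x≡𝟙 x) ⟩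
    y ⇝ 𝟙        ≡⟨ x⇝𝟙≡x⁻ y ⟩
    y ⇒ 𝟙        ∎

  x⇝[y⇒x]≡y⁻ : ∀ x y → x ⇝ (y ⇒ x) ≡ y ⁻
  x⇝[y⇒x]≡y⁻ x y = begin
    x ⇝ (y ⇒ x)  ≡⟨ exchange y x x ⟨
    y ⇒ (x ⇝ x)  ≡⟨ cong (y ⇒_) (x⇝x≡𝟙 x) ⟩
    y ⇒ 𝟙        ∎

  ⁻-≤-invariant : ∀ {x y} → y ≤ x → x ⁻ ≡ y ⁻
  ⁻-≤-invariant {x} {y} y≤x = begin
    x ⇒ 𝟙        ≡⟨ cong (x ⇒_) (≤→⇝≡𝟙 y≤x) ⟨
    x ⇒ (y ⇝ x)  ≡⟨ x⇒[y⇝x]≡y⁻ x y ⟩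
    y ⁻          ∎

  x≤dφx : ∀ x → x ≤ dφ x
  x≤dφx x = x≤x⋓₁y x 𝟙

  dφx≡x⁻⁻ : ∀ x → dφ x ≡ x ⁻ ⁻
  dφx≡x⁻⁻ x = x⇝𝟙≡x⁻ (x ⁻)

  x⁻⁻⁻≡x⁻ : ∀ x → x ⁻ ⁻ ⁻ ≡ x ⁻
  x⁻⁻⁻≡x⁻ x = ⁻-≤-invariant (subst (x ≤_) (dφx≡x⁻⁻ x) (x≤dφx x))

  Maximal : Carrier → Set a
  Maximal m = ∀ {c} → m ≤ c → c ≡ m

  ≤-maximal : ∀ {m c} → Maximal m → m ≤ c → Maximal c
  ≤-maximal max-m m≤c rewrite max-m m≤c = max-m

  x⁻-maximal : ∀ x → Maximal (x ⁻)
  x⁻-maximal x {c} x⁻≤c = ≤-antisym c≤x⁻ x⁻≤c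
    where
    c⁻⁻≡x⁻ : c ⁻ ⁻ ≡ x ⁻
    c⁻⁻≡x⁻ = trans (cong _⁻ (⁻-≤-invariant x⁻≤c)) (x⁻⁻⁻≡x⁻ x)

    c≤x⁻ : c ≤ x ⁻
    c≤x⁻ = subst (c ≤_) (trans (dφx≡x⁻⁻ c) c⁻⁻≡x⁻) (x≤dφx c)

  maximal-above-is-dφ : ∀ {x m} → x ≤ m → Maximal m → m ≡ dφ x
  maximal-above-is-dφ {x} {m} x≤m max-m = begin
    m          ≡⟨ max-m (x≤dφx m) ⟨
    m ⁻ ⇝ 𝟙    ≡⟨ cong (_⇝ 𝟙) (⁻-≤-invariant x≤m) ⟩
    x ⁻ ⇝ 𝟙    ∎

  dφ≡maximal⋓₂ : ∀ {x m} b → x ≤ m → Maximal m → dφ x ≡ m ⋓₂ b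
  dφ≡maximal⋓₂ b x≤m max-m = trans (sym (maximal-above-is-dφ x≤m max-m)) (sym (max-m (x≤x⋓₂y _ b)))

  dφ≡maximal⋓₁ : ∀ {x m} b → x ≤ m → Maximal m → dφ x ≡ m ⋓₁ b
  dφ≡maximal⋓₁ b x≤m max-m = trans (sym (maximal-above-is-dφ x≤m max-m)) (sym (max-m (x≤x⋓₁y _ b)))

  [y⇒x]⁻≤y⁻⇝x⁻ : ∀ x y → (y ⇒ x) ⁻ ≤ y ⁻ ⇝ x ⁻
  [y⇒x]⁻≤y⁻⇝x⁻ x y = begin
    (y ⇒ x) ⁻ ⇒ (y ⁻ ⇝ x ⁻)  ≡⟨ exchange _ _ _ ⟩
    y ⁻ ⇝ ((y ⇒ x) ⁻ ⇒ x ⁻)  ≡⟨ ≤→⇝≡𝟙 y⁻≤[y⇒x]⁻⇒x⁻ ⟩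
    𝟙                        ∎
    where
    y⁻≤[y⇒x]⁻⇒x⁻ : y ⁻ ≤ (y ⇒ x) ⁻ ⇒ x ⁻
    y⁻≤[y⇒x]⁻⇒x⁻ = begin
      y ⁻ ⇒ ((y ⇒ x) ⁻ ⇒ x ⁻)                  ≡⟨ cong₂ (λ u v → u ⇒ (v ⇒ x ⁻)) (x⇝[y⇒x]≡y⁻ x y) (x⇝𝟙≡x⁻ (y ⇒ x)) ⟨
      (x ⇝ (y ⇒ x)) ⇒ (((y ⇒ x) ⇝ 𝟙) ⇒ x ⁻)    ≡⟨ cong (λ v → (x ⇝ (y ⇒ x)) ⇒ (((y ⇒ x) ⇝ 𝟙) ⇒ v)) (x⇝𝟙≡x⁻ x) ⟨
      (x ⇝ (y ⇒ x)) ⇒ (((y ⇒ x) ⇝ 𝟙) ⇒ (x ⇝ 𝟙)) ≡⟨ ax₂ x (y ⇒ x) 𝟙 ⟩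
      𝟙                                        ∎

  [y⇝x]⁻≤y⁻⇒x⁻ : ∀ x y → (y ⇝ x) ⁻ ≤ y ⁻ ⇒ x ⁻
  [y⇝x]⁻≤y⁻⇒x⁻ x y = ⇝≡𝟙→≤ (begin
    (y ⇝ x) ⁻ ⇝ (y ⁻ ⇒ x ⁻)  ≡⟨ exchange _ _ _ ⟨
    y ⁻ ⇒ ((y ⇝ x) ⁻ ⇝ x ⁻)  ≡⟨ ⇝≡𝟙→≤ y⁻⇝[[y⇝x]⁻⇝x⁻]≡𝟙 ⟩
    𝟙                        ∎)
    where
    y⁻⇝[[y⇝x]⁻⇝x⁻]≡𝟙 : y ⁻ ⇝ ((y ⇝ x) ⁻ ⇝ x ⁻) ≡ 𝟙
    y⁻⇝[[y⇝x]⁻⇝x⁻]≡𝟙 = subst (λ u → u ⇝ ((y ⇝ x) ⁻ ⇝ x ⁻) ≡ 𝟙) (x⇒[y⇝x]≡y⁻ x y) (ax₁ x (y ⇝ x) 𝟙)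

  x⇒dφy≡y⁻⇝x⁻ : ∀ x y → x ⇒ dφ y ≡ y ⁻ ⇝ x ⁻
  x⇒dφy≡y⁻⇝x⁻ x y = exchange x (y ⁻) 𝟙

  x⇝dφy≡y⁻⇒x⁻ : ∀ x y → x ⇝ dφ y ≡ y ⁻ ⇒ x ⁻
  x⇝dφy≡y⁻⇒x⁻ x y = begin
    x ⇝ (y ⁻ ⇝ 𝟙)  ≡⟨ cong (x ⇝_) (x⇝𝟙≡x⁻ (y ⁻)) ⟩
    x ⇝ (y ⁻ ⇒ 𝟙)  ≡⟨ exchange (y ⁻) x 𝟙 ⟨
    y ⁻ ⇒ (x ⇝ 𝟙)  ≡⟨ cong (y ⁻ ⇒_) (x⇝𝟙≡x⁻ x) ⟩
    y ⁻ ⇒ x ⁻      ∎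

  x⇒y≤x⇒dφy : ∀ x y → x ⇒ y ≤ x ⇒ dφ y
  x⇒y≤x⇒dφy x y = subst (x ⇒ y ≤_) (sym (x⇒dφy≡y⁻⇝x⁻ x y)) (⇝≡𝟙→≤ (ax₁ x y 𝟙))

  x⇝y≤x⇝dφy : ∀ x y → x ⇝ y ≤ x ⇝ dφ y
  x⇝y≤x⇝dφy x y = subst (x ⇝ y ≤_) (sym (x⇝dφy≡y⁻⇒x⁻ x y))
    (subst₂ (λ u v → x ⇝ y ≤ u ⇒ v) (x⇝𝟙≡x⁻ y) (x⇝𝟙≡x⁻ x) (ax₂ x y 𝟙))

  x⇒dφy-maximal : ∀ x y → Maximal (x ⇒ dφ y)
  x⇒dφy-maximal x y = subst Maximal (sym (x⇒dφy≡y⁻⇝x⁻ x y))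
    (≤-maximal (x⁻-maximal (y ⇒ x)) ([y⇒x]⁻≤y⁻⇝x⁻ x y))

  x⇝dφy-maximal : ∀ x y → Maximal (x ⇝ dφ y)
  x⇝dφy-maximal x y = subst Maximal (sym (x⇝dφy≡y⁻⇒x⁻ x y))
    (≤-maximal (x⁻-maximal (y ⇝ x)) ([y⇝x]⁻≤y⁻⇒x⁻ x y))

proposition3p7 : ∀ {a} (A : PseudoBCI a) → IsTypeIImplicativeDerivation A (PseudoBCI.dφ A)
proposition3p7 A = dφ-⇒ , dφ-⇝
  where
  open PseudoBCI A
  open Properties A

  dφ-⇒ : ∀ x y → dφ (x ⇒ y) ≡ (x ⇒ dφ y) ⋓₂ (dφ x ⇒ y)
  dφ-⇒ x y = dφ≡maximal⋓₂ (dφ x ⇒ y) (x⇒y≤x⇒dφy x y) (x⇒dφy-maximal x y)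

  dφ-⇝ : ∀ x y → dφ (x ⇝ y) ≡ (x ⇝ dφ y) ⋓₁ (dφ x ⇝ y)
  dφ-⇝ x y = dφ≡maximal⋓₁ (dφ x ⇝ y) (x⇝y≤x⇝dφy x y) (x⇝dφy-maximal x y)
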